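{- Let $G$ be a finite graph, $T$ an $\ell$-complete tree decomposition of $G$, and $u,v$ two nodes of $T$. Root $T$ at $u$ and let $T_v$ be the subtree of $T$ consisting of $v$ and its descendants. Let $\alpha$ be a proper coloring of $G$ which is $(V\setminus B_u)$-coherent with respect to $T$, and let $a$ be a color that is used by no vertex of $B_u$. If some vertex of $B_v$ has color $a$ under $\alpha$, then every bag of a node of $T_v$ contains a vertex colored $a$.
   Context: A tree decomposition of $G=(V,E)$ is a tree $T$ with bags $B_w\subseteq V$ for each node $w$ such that each edge of $G$ lies in some bag and, for each $x\in V$, the nodes whose bags contain $x$ form a non-empty subtree. It is $\ell$-complete if every bag has exactly $\ell+1$ vertices and adjacent nodes $w,w'$ satisfy $|B_w\cap B_{w'}|=\ell$. Two vertices $x,y$ are $T$-parents if there are adjacent nodes $w,w'$ with $B_w\setminus B_{w'}=\{x\}$ and $B_{w'}\setminus B_w=\{y\}$. For $X\subseteq V$, a coloring $\alpha$ is $X$-coherent (with respect to $T$) if $\alpha(x)=\alpha(y)$ for all $T$-parents $x,y\in X$, and for every bag $B$ and every $x\in X\cap B$, $x$ is the only vertex of $B$ colored $\alpha(x)$. -}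

module Defs where

open import Level using (0ℓ)
open import Data.Nat using (ℕ; suc)
open import Data.Fin using (Fin)
open import Data.Fin.Subset using (Subset; _∈_; _∉_; ∁; _∩_; _─_; ⁅_⁆; ∣_∣)
open import Data.List using (List; []; _∷_)
open import Data.List.Membership.Propositional using () renaming (_∈_ to _∈ˡ_)
open import Data.List.Relation.Unary.All using (All)
open import Data.List.Relation.Unary.Unique.Propositional using (Unique)
open import Data.Product using (Σ; ∃; _×_; _,_)
open import Relation.Binary.PropositionalEquality using (_≡_; _≢_)
open import Relation.Nullary using (¬_)

record Graph (n : ℕ) : Set₁ where
  field
    Adj     : Fin n → Fin n → Set
    symm    : ∀ {x y} → Adj x y → Adj y x
    irrefl  : ∀ {x} → ¬ Adj x x

data Walk {m : ℕ} (R : Fin m → Fin m → Set) : Fin m → Fin m → Set where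
  stop : ∀ {x} → Walk R x x
  step : ∀ {x y z} → R x y → Walk R y z → Walk R x z

verts : ∀ {m} {R : Fin m → Fin m → Set} {x y} → Walk R x y → List (Fin m)
verts {x = x} stop = x ∷ []
verts {x = x} (step _ w) = x ∷ verts w

IsPath : ∀ {m} {R : Fin m → Fin m → Set} {x y} → Walk R x y → Set
IsPath w = Unique (verts w)

record Tree (m : ℕ) : Set₁ where
  field
    graph       : Graph m
  open Graph graph public
  field
    pathExists  : ∀ x y → Σ (Walk Adj x y) IsPath
    pathUnique  : ∀ {x y} (p q : Walk Adj x y) → IsPath p → IsPath q → verts p ≡ verts q

record IsTreeDecomposition {n m : ℕ} (G : Graph n) (T : Tree m) (B : Fin m → Subset n) : Set where
  field
    edgeCovered : ∀ x y → Graph.Adj G x y → ∃ λ w → x ∈ B w × y ∈ B w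
    vertexIn    : ∀ x → ∃ λ w → x ∈ B w
    connected   : ∀ x w w' → x ∈ B w → x ∈ B w' →
                  Σ (Walk (Tree.Adj T) w w') λ p → All (λ z → x ∈ B z) (verts p)

IsComplete : ∀ {n m} (ℓ : ℕ) (T : Tree m) (B : Fin m → Subset n) → Set
IsComplete ℓ T B =
  (∀ w → ∣ B w ∣ ≡ suc ℓ) × (∀ w w' → Tree.Adj T w w' → ∣ B w ∩ B w' ∣ ≡ ℓ)

TParents : ∀ {n m} (T : Tree m) (B : Fin m → Subset n) → Fin n → Fin n → Set
TParents T B x y = ∃ λ w → ∃ λ w' →
  Tree.Adj T w w' × (B w ─ B w') ≡ ⁅ x ⁆ × (B w' ─ B w) ≡ ⁅ y ⁆

Coloring : ℕ → Set
Coloring n = Fin n → ℕ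

IsProper : ∀ {n} (G : Graph n) → Coloring n → Set
IsProper G α = ∀ x y → Graph.Adj G x y → α x ≢ α y

IsCoherent : ∀ {n m} (T : Tree m) (B : Fin m → Subset n) (X : Subset n) → Coloring n → Set
IsCoherent T B X α =
  (∀ x y → x ∈ X → y ∈ X → TParents T B x y → α x ≡ α y) ×
  (∀ w x → x ∈ X → x ∈ B w → ∀ z → z ∈ B w → α z ≡ α x → z ≡ x)

-- Rooting T at u, w is a node of T_v (v or a descendant of v) iff v lies on the
-- (unique) path from u to w.
InSubtree : ∀ {m} (T : Tree m) (u v w : Fin m) → Set
InSubtree T u v w = Σ (Walk (Tree.Adj T) u w) λ p → IsPath p × v ∈ˡ verts p

-- Follow the tree path from v to w.  If a bag B s on it contains a vertex x of
-- colour a but the next bag B t does not, ℓ-completeness makes x and the unique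
-- vertex y of B t ─ B s into T-parents.  Neither lies in B u: x because of its
-- colour, and y because the bags containing y form a subtree containing u and
-- t, hence the whole path from t to u, which passes through s.  Coherence on
-- ∁ (B u) then gives α y ≡ α x ≡ a.
module Submission where

open import Defs
open import Data.Nat using (ℕ; suc; _+_)
open import Data.Nat.Properties using (+-cancelˡ-≡; +-comm; +-suc; suc-injective)
open import Data.Bool using (true; false)
open import Data.Fin using (Fin) renaming (_≟_ to _≟ᶠ_)
open import Data.Fin.Subset using (Subset; _∈_; _∉_; ∁; _∩_; _─_; ⁅_⁆; ∣_∣; Nonempty)
open import Data.Fin.Subset.Properties
  using (x∈p∧x∉q⇒x∈p─q; p─q⊆p; x∉p⇒x∈∁p; nonempty?; Empty-unique; ∣⊥∣≡0; _∈?_)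
open import Data.Vec using (_∷_; []; here; there)
open import Data.List using (List; _∷_; _∷ʳ_)
open import Data.List.Membership.Propositional using () renaming (_∈_ to _∈ˡ_)
open import Data.List.Relation.Binary.Subset.Propositional using (_⊆_)
open import Data.List.Relation.Binary.Permutation.Propositional
  using (_↭_; ↭-refl; ↭-sym; ↭-trans; ↭-prep; ↭⇒↭ₛ)
open import Data.List.Relation.Binary.Permutation.Propositional.Properties using (∷↭∷ʳ; ∈-resp-↭)
import Data.List.Relation.Binary.Permutation.Setoid.Properties as Permutationₛ
open import Data.List.Relation.Unary.Any using (here; there; any?)
open import Data.List.Relation.Unary.All as All using (All)
open import Data.List.Relation.Unary.All.Properties using (¬Any⇒All¬)
open import Data.List.Relation.Unary.AllPairs using ([]; _∷_)
open import Data.List.Relation.Unary.Unique.Propositional using (Unique)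
open import Data.Product using (Σ; ∃; _×_; _,_; proj₁; proj₂)
open import Relation.Nullary using (yes; no; contradiction)
open import Relation.Binary.PropositionalEquality
  using (_≡_; _≢_; refl; sym; trans; cong; subst; setoid; module ≡-Reasoning)

Unique-resp-↭ : ∀ {A : Set} {xs ys : List A} → xs ↭ ys → Unique xs → Unique ys
Unique-resp-↭ {A} σ = Permutationₛ.Unique-resp-↭ (setoid A) (↭⇒↭ₛ σ)

∣p∣≡∣p∩q∣+∣p─q∣ : ∀ {n} (p q : Subset n) → ∣ p ∣ ≡ ∣ p ∩ q ∣ + ∣ p ─ q ∣
∣p∣≡∣p∩q∣+∣p─q∣ []          []          = refl
∣p∣≡∣p∩q∣+∣p─q∣ (true ∷ p)  (true ∷ q)  = cong suc (∣p∣≡∣p∩q∣+∣p─q∣ p q)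
∣p∣≡∣p∩q∣+∣p─q∣ (true ∷ p)  (false ∷ q) =
  trans (cong suc (∣p∣≡∣p∩q∣+∣p─q∣ p q)) (sym (+-suc ∣ p ∩ q ∣ ∣ p ─ q ∣))
∣p∣≡∣p∩q∣+∣p─q∣ (false ∷ p) (true ∷ q)  = ∣p∣≡∣p∩q∣+∣p─q∣ p q
∣p∣≡∣p∩q∣+∣p─q∣ (false ∷ p) (false ∷ q) = ∣p∣≡∣p∩q∣+∣p─q∣ p q

x∈p─q⇒x∉q : ∀ {n} {x : Fin n} (p q : Subset n) → x ∈ p ─ q → x ∉ q
x∈p─q⇒x∉q (_ ∷ p) (_ ∷ q) (there x∈p─q) (there x∈q) = x∈p─q⇒x∉q p q x∈p─q x∈q

∣p∣≡0⇒x∉p : ∀ {n} {x : Fin n} (p : Subset n) → ∣ p ∣ ≡ 0 → x ∉ p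
∣p∣≡0⇒x∉p (false ∷ p) ∣p∣≡0 (there x∈p) = ∣p∣≡0⇒x∉p p ∣p∣≡0 x∈p

∣p∣≡1⇒p≡⁅x⁆ : ∀ {n} {x : Fin n} (p : Subset n) → ∣ p ∣ ≡ 1 → x ∈ p → p ≡ ⁅ x ⁆
∣p∣≡1⇒p≡⁅x⁆ (true ∷ p) ∣p∣≡1 here =
  cong (true ∷_) (Empty-unique λ (_ , y∈p) → ∣p∣≡0⇒x∉p p (suc-injective ∣p∣≡1) y∈p)
∣p∣≡1⇒p≡⁅x⁆ (true ∷ p) ∣p∣≡1 (there x∈p) =
  contradiction x∈p (∣p∣≡0⇒x∉p p (suc-injective ∣p∣≡1))
∣p∣≡1⇒p≡⁅x⁆ (false ∷ p) ∣p∣≡1 (there x∈p) = cong (false ∷_) (∣p∣≡1⇒p≡⁅x⁆ p ∣p∣≡1 x∈p)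

∣p∣≡1+k⇒Nonempty : ∀ {n k} (p : Subset n) → ∣ p ∣ ≡ suc k → Nonempty p
∣p∣≡1+k⇒Nonempty {n} p ∣p∣≡1+k with nonempty? p
... | yes ne = ne
... | no ¬ne with () ← trans (sym ∣p∣≡1+k) (trans (cong ∣_∣ (Empty-unique ¬ne)) (∣⊥∣≡0 n))

module _ {m : ℕ} {R : Fin m → Fin m → Set} where

  start∈verts : ∀ {x y} (w : Walk R x y) → x ∈ˡ verts w
  start∈verts stop       = here refl
  start∈verts (step _ _) = here refl

  suffixPath : ∀ {x y z} (p : Walk R x z) → IsPath p → y ∈ˡ verts p →
               Σ (Walk R y z) λ q → IsPath q × verts q ⊆ verts p
  suffixPath stop         p-path (here refl) = stop , p-path , λ i → i
  suffixPath p@(step _ _) p-path (here refl) = p , p-path , λ i → i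
  suffixPath (step _ p) (_ ∷ p-path) (there y∈p) with suffixPath p p-path y∈p
  ... | q , q-path , q⊆p = q , q-path , λ i → there (q⊆p i)

  prune : ∀ {x y} (w : Walk R x y) → Σ (Walk R x y) λ p → IsPath p × verts p ⊆ verts w
  prune stop = stop , All.[] ∷ [] , λ i → i
  prune {x} (step r w) with prune w
  ... | p , p-path , p⊆w with any? (x ≟ᶠ_) (verts p)
  ...   | yes x∈p = let q , q-path , q⊆p = suffixPath p p-path x∈p
                    in q , q-path , λ i → there (p⊆w (q⊆p i))
  ...   | no x∉p  = step r p , ¬Any⇒All¬ (verts p) x∉p ∷ p-path ,
                    λ { (here e) → here e ; (there i) → there (p⊆w i) }

  snoc : ∀ {x y z} → Walk R x y → R y z → Walk R x z
  snoc stop       r = step r stop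
  snoc (step s w) r = step s (snoc w r)

  verts-snoc : ∀ {x y z} (w : Walk R x y) (r : R y z) → verts (snoc w r) ≡ verts w ∷ʳ z
  verts-snoc stop       r = refl
  verts-snoc (step s w) r = cong (_ ∷_) (verts-snoc w r)

  module _ (R-sym : ∀ {x y} → R x y → R y x) where

    reverse : ∀ {x y} → Walk R x y → Walk R y x
    reverse stop       = stop
    reverse (step r w) = snoc (reverse w) (R-sym r)

    verts-reverse : ∀ {x y} (w : Walk R x y) → verts (reverse w) ↭ verts w
    verts-reverse stop = ↭-refl
    verts-reverse {x} (step r w) rewrite verts-snoc (reverse w) (R-sym r) =
      ↭-trans (↭-sym (∷↭∷ʳ x (verts (reverse w)))) (↭-prep x (verts-reverse w))

    reverse-IsPath : ∀ {x y} {w : Walk R x y} → IsPath w → IsPath (reverse w)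
    reverse-IsPath {w = w} = Unique-resp-↭ (↭-sym (verts-reverse w))

module _ {n m : ℕ} {G : Graph n} {T : Tree m} {B : Fin m → Subset n}
         (TD : IsTreeDecomposition G T B) where

  open Tree T using (Adj; pathUnique)

  path-within-bags : ∀ {s t y} (p : Walk Adj s t) → IsPath p →
                     y ∈ B s → y ∈ B t → All (λ z → y ∈ B z) (verts p)
  path-within-bags {s} {t} {y} p p-path y∈s y∈t
    with IsTreeDecomposition.connected TD y s t y∈s y∈t
  ... | w , w-in-bags with prune w
  ...   | q , q-path , q⊆w = subst (All (λ z → y ∈ B z)) (pathUnique q p q-path p-path)
                               (All.tabulate λ z∈q → All.lookup w-in-bags (q⊆w z∈q))

module _ {n m : ℕ} {ℓ : ℕ} {T : Tree m} {B : Fin m → Subset n}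
         (complete : IsComplete ℓ T B) where

  open Tree T using (Adj; symm)

  complete⇒∣B─B∣≡1 : ∀ {s t} → Adj s t → ∣ B s ─ B t ∣ ≡ 1
  complete⇒∣B─B∣≡1 {s} {t} r = +-cancelˡ-≡ ℓ _ _ (begin
    ℓ + ∣ B s ─ B t ∣             ≡⟨ cong (_+ ∣ B s ─ B t ∣) (proj₂ complete s t r) ⟨
    ∣ B s ∩ B t ∣ + ∣ B s ─ B t ∣ ≡⟨ ∣p∣≡∣p∩q∣+∣p─q∣ (B s) (B t) ⟨
    ∣ B s ∣                       ≡⟨ proj₁ complete s ⟩
    suc ℓ                         ≡⟨ +-comm 1 ℓ ⟩
    ℓ + 1                         ∎)
    where open ≡-Reasoning

  leaving⇒TParents : ∀ {s t x} → Adj s t → x ∈ B s → x ∉ B t →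
                     ∃ λ y → y ∈ B t × y ∉ B s × TParents T B x y
  leaving⇒TParents {s} {t} {x} r x∈s x∉t
    with ∣p∣≡1+k⇒Nonempty (B t ─ B s) (complete⇒∣B─B∣≡1 (symm r))
  ... | y , y∈t─s =
    y , p─q⊆p (B t) (B s) y∈t─s , x∈p─q⇒x∉q (B t) (B s) y∈t─s ,
    s , t , r ,
    ∣p∣≡1⇒p≡⁅x⁆ (B s ─ B t) (complete⇒∣B─B∣≡1 r) (x∈p∧x∉q⇒x∈p─q x∈s x∉t) ,
    ∣p∣≡1⇒p≡⁅x⁆ (B t ─ B s) (complete⇒∣B─B∣≡1 (symm r)) y∈t─s

BagHasColour : ∀ {n m} (B : Fin m → Subset n) (α : Coloring n) (a : ℕ) (w : Fin m) → Set
BagHasColour B α a w = ∃ λ x → x ∈ B w × α x ≡ a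

module _ {n m ℓ : ℕ} {G : Graph n} {T : Tree m} {B : Fin m → Subset n}
         (TD : IsTreeDecomposition G T B) (complete : IsComplete ℓ T B)
         {u : Fin m} {α : Coloring n} (coherent : IsCoherent T B (∁ (B u)) α)
         {a : ℕ} (a∉αBu : ∀ x → x ∈ B u → α x ≢ a) where

  open Tree T using (Adj; symm)

  colour-crosses-edge : ∀ {s t} → Adj s t → (∀ {y} → y ∈ B u → y ∈ B t → y ∈ B s) →
                        BagHasColour B α a s → BagHasColour B α a t
  colour-crosses-edge {s} {t} r Bu∩Bt⊆Bs (x , x∈s , αx≡a) with x ∈? B t
  ... | yes x∈t = x , x∈t , αx≡a
  ... | no x∉t with leaving⇒TParents {ℓ = ℓ} {T} {B} complete r x∈s x∉t
  ...   | y , y∈t , y∉s , parents = y , y∈t , trans (sym αx≡αy) αx≡a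
    where
    αx≡αy : α x ≡ α y
    αx≡αy = proj₁ coherent x y (x∉p⇒x∈∁p λ x∈u → a∉αBu x x∈u αx≡a)
                               (x∉p⇒x∈∁p λ y∈u → y∉s (Bu∩Bt⊆Bs y∈u y∈t)) parents

  colour-spreads-along-path : ∀ {v t} (p : Walk Adj t u) → IsPath p → v ∈ˡ verts p →
                              BagHasColour B α a v → BagHasColour B α a t
  colour-spreads-along-path stop         _                    (here refl) hv = hv
  colour-spreads-along-path (step _ _)   _                    (here refl) hv = hv
  colour-spreads-along-path p@(step r q) p-path@(_ ∷ q-path) (there v∈q) hv =
    colour-crosses-edge (symm r)
      (λ y∈u y∈t → All.lookup (path-within-bags TD p p-path y∈t y∈u) (there (start∈verts q)))
      (colour-spreads-along-path q q-path v∈q hv)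

lemma5 : ∀ {n m : ℕ} (ℓ : ℕ) (G : Graph n) (T : Tree m) (B : Fin m → Subset n) →
         IsTreeDecomposition G T B → IsComplete ℓ T B →
         (u v : Fin m) (α : Coloring n) → IsProper G α →
         IsCoherent T B (∁ (B u)) α →
         (a : ℕ) → (∀ x → x ∈ B u → α x ≢ a) →
         (∃ λ x → x ∈ B v × α x ≡ a) →
         ∀ w → InSubtree T u v w → ∃ λ x → x ∈ B w × α x ≡ a
lemma5 ℓ G T B TD complete u v α _ coherent a a∉αBu hv w (p , p-path , v∈p) =
  colour-spreads-along-path TD complete coherent a∉αBu
    (reverse symm p) (reverse-IsPath symm p-path)
    (∈-resp-↭ (↭-sym (verts-reverse symm p)) v∈p) hv
  where open Tree T using (symm)
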